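{- For a positive integer $n$, the set of Lucas strings of length $n$ contains an asymmetric string if and only if $n\ge 9$.
   Context: A Lucas string of length $n$ is a binary string $u_1\cdots u_n$ with no two consecutive 1s and not both $u_1=1$ and $u_n=1$. For $u=u_1\cdots u_n$ let $\alpha(u)=u_nu_1\cdots u_{n-1}$ (cyclic shift) and $\beta(u)=u_n\cdots u_1$ (reversal); $\bar u$ is the orbit of $u$ under the group generated by $\alpha$ and $\beta$. The string $u$ of length $n$ is asymmetric if $|\bar u|=2n$ (and symmetric if $|\bar u|<2n$). -}

module Defs where

open import Data.Nat using (ℕ; zero; suc; _+_)
open import Data.Bool using (Bool; true; false)
open import Data.Vec using (Vec; []; _∷_; head; last; reverse; _∷ʳ_; init)
open import Data.Vec.Properties using (≡-dec)
open import Data.Bool.Properties using () renaming (_≟_ to _≟B_)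
open import Data.List using (List; []; _∷_; length; map; _++_; upTo; deduplicate)
open import Relation.Binary.PropositionalEquality using (_≡_)
open import Relation.Nullary using (¬_)
open import Data.Product using (_×_)

BinStr : ℕ → Set
BinStr n = Vec Bool n

data NoAdj11 : {n : ℕ} → BinStr n → Set where
  nil  : NoAdj11 []
  one  : ∀ b → NoAdj11 (b ∷ [])
  cons0 : ∀ {n} {b : Bool} {u : BinStr n} → NoAdj11 (b ∷ u) → NoAdj11 (false ∷ b ∷ u)
  cons1 : ∀ {n} {u : BinStr n} → NoAdj11 (false ∷ u) → NoAdj11 (true ∷ false ∷ u)

IsLucas : {n : ℕ} → BinStr n → Set
IsLucas [] = NoAdj11 []
IsLucas {suc n} u = NoAdj11 u × ¬ (head u ≡ true × last u ≡ true)

α : {n : ℕ} → BinStr n → BinStr n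
α [] = []
α {suc n} u = last u ∷ init u

β : {n : ℕ} → BinStr n → BinStr n
β = reverse

iter : {A : Set} → ℕ → (A → A) → A → A
iter zero f x = x
iter (suc k) f x = f (iter k f x)

-- The group ⟨α, β⟩ acting on strings of length n is the dihedral group whose
-- elements are α^k and α^k ∘ β for 0 ≤ k < n (for n ≥ 1).
orbitList : {n : ℕ} → BinStr n → List (BinStr n)
orbitList {n} u = map (λ k → iter k α u) (upTo n) ++ map (λ k → iter k α (β u)) (upTo n)

orbitSize : {n : ℕ} → BinStr n → ℕ
orbitSize {n} u = length (deduplicate (≡-dec _≟B_) (orbitList u))

Asymmetric : {n : ℕ} → BinStr n → Set
Asymmetric {n} u = orbitSize u ≡ n + n

-- A string u of length n is asymmetric as soon as no rotation αᵏu with 0 < k < n equals u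
-- (its list is primitive) and no rotation equals βu (its list is chiral): together with
-- αⁿ = id this makes the 2n images αⁱu and αʲ(βu) pairwise distinct.  On lists a rotation is
-- a swap xs ++ ys ↦ ys ++ xs, so both conditions are checked on splittings of the list.
-- For n = 9 + m the Lucas string 101001 0^(3+m) qualifies: cyclically its three 1s are
-- separated by gaps 2, 3 and 4 + m, which are pairwise distinct.  For n ≤ 8 all 2ⁿ strings
-- are checked by evaluation.
module Submission where

open import Defs
open import Data.Bool using (Bool; true; false)
open import Data.Bool.Properties using () renaming (_≟_ to _≟ᵇ_)
open import Data.Fin using (Fin; toℕ; fromℕ<)
import Data.Fin.Properties as Fin
open import Data.List
  using (List; []; _∷_; _++_; [_]; _∷ʳ_; length; reverse; replicate; take; drop; applyUpTo; deduplicate; filter)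
open import Data.List.Properties
  using ( ++-assoc; ++-identityʳ; ∷ʳ-injective; unfold-reverse; reverse-++; reverse-involutive
        ; reverse-injective; take++drop≡id; length-drop; length-++; length-applyUpTo; map-applyUpTo; filter-all)
open import Data.List.Membership.Propositional.Properties using (∈-applyUpTo⁻)
open import Data.List.Relation.Binary.Disjoint.Propositional using (Disjoint)
open import Data.List.Relation.Unary.All using (All; []; _∷_)
open import Data.List.Relation.Unary.All.Properties using (++⁻ʳ; replicate⁺)
open import Data.List.Relation.Unary.AllPairs using ([]; _∷_)
open import Data.List.Relation.Unary.Unique.Propositional using (Unique)
import Data.List.Relation.Unary.Unique.Propositional.Properties as Unique
open import Data.Nat using (ℕ; zero; suc; _+_; _∸_; _≤_; _<_; _≥_; s≤s; s<s⁻¹; _≤?_)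
open import Data.Nat.Properties
  using (_≟_; <⇒≤; ≤-trans; <-irrefl; ≤-<-trans; ≮⇒≥; ≰⇒>; m∸n≤m; m<n⇒0<n∸m; m+[n∸m]≡n; m∸n+n≡m; m∸[m∸n]≡n)
open import Data.Product using (∃; ∃₂; _×_; _,_; proj₁; proj₂)
import Data.Sum as Sum
open import Data.Sum using (_⊎_; inj₁; inj₂)
open import Data.Vec as V using (Vec; []; _∷_; toList)
import Data.Vec.Properties as V
open import Data.Vec.Relation.Binary.Equality.Cast using (cast-is-id)
open import Function using (_∘_; id; case_of_)
open import Function.Bundles using (_⇔_; mk⇔)
open import Relation.Binary.Definitions using (DecidableEquality)
open import Relation.Binary.PropositionalEquality hiding ([_])
open import Relation.Nullary using (¬_; Dec; yes; no; ¬?; _×-dec_)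
open import Relation.Nullary.Decidable using (map′; from-yes)

open ≡-Reasoning

module _ {A : Set} where

  replicate-∷ʳ : ∀ n (x : A) → replicate n x ∷ʳ x ≡ x ∷ replicate n x
  replicate-∷ʳ zero    x = refl
  replicate-∷ʳ (suc n) x = cong (x ∷_) (replicate-∷ʳ n x)

  reverse-replicate : ∀ n (x : A) → reverse (replicate n x) ≡ replicate n x
  reverse-replicate zero    x = refl
  reverse-replicate (suc n) x = begin
    reverse (x ∷ replicate n x)   ≡⟨ unfold-reverse x (replicate n x) ⟩
    reverse (replicate n x) ∷ʳ x  ≡⟨ cong (_∷ʳ x) (reverse-replicate n x) ⟩
    replicate n x ∷ʳ x            ≡⟨ replicate-∷ʳ n x ⟩
    x ∷ replicate n x             ∎

  ++-≡-replicate⇒Allʳ : ∀ xs {ys n} {x : A} → xs ++ ys ≡ replicate n x → All (_≡ x) ys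
  ++-≡-replicate⇒Allʳ xs {n = n} eq = ++⁻ʳ xs (subst (All (_≡ _)) (sym eq) (replicate⁺ n refl))

  split-with-suffix-length : ∀ (l : List A) {k} → k ≤ length l →
                             ∃₂ λ xs ys → l ≡ xs ++ ys × length ys ≡ k
  split-with-suffix-length l {k} k≤∣l∣ =
    take i l , drop i l , sym (take++drop≡id i l) , trans (length-drop i l) (m∸[m∸n]≡n k≤∣l∣)
    where i = length l ∸ k

  deduplicate-Unique : (_≟_ : DecidableEquality A) {xs : List A} → Unique xs → deduplicate _≟_ xs ≡ xs
  deduplicate-Unique _≟_ []                 = refl
  deduplicate-Unique _≟_ {x ∷ xs} (x∉xs ∷ xs!) = cong (x ∷_) (begin
    filter (¬? ∘ (x ≟_)) (deduplicate _≟_ xs) ≡⟨ cong (filter (¬? ∘ (x ≟_))) (deduplicate-Unique _≟_ xs!) ⟩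
    filter (¬? ∘ (x ≟_)) xs                   ≡⟨ filter-all (¬? ∘ (x ≟_)) x∉xs ⟩
    xs                                        ∎)

  -- For nonempty l this is equivalent to l not being a proper power of a word.
  Primitive : List A → Set
  Primitive l = ∀ xs ys → l ≡ xs ++ ys → ys ++ xs ≡ l → xs ≡ [] ⊎ ys ≡ []

  Chiral : List A → Set
  Chiral l = ∀ xs ys → l ≡ xs ++ ys → ys ++ xs ≢ reverse l

  primitive-reverse : ∀ {l} → Primitive l → Primitive (reverse l)
  primitive-reverse {l} prim xs ys l̅≡xs++ys ys++xs≡l̅ =
    Sum.swap (Sum.map reverse-injective reverse-injective (prim (reverse ys) (reverse xs) l≡ l≡′))
    where
    l≡ : l ≡ reverse ys ++ reverse xs
    l≡ = begin
      l                        ≡⟨ reverse-involutive l ⟨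
      reverse (reverse l)      ≡⟨ cong reverse l̅≡xs++ys ⟩
      reverse (xs ++ ys)       ≡⟨ reverse-++ xs ys ⟩
      reverse ys ++ reverse xs ∎
    l≡′ : reverse xs ++ reverse ys ≡ l
    l≡′ = begin
      reverse xs ++ reverse ys ≡⟨ reverse-++ ys xs ⟨
      reverse (ys ++ xs)       ≡⟨ cong reverse ys++xs≡l̅ ⟩
      reverse (reverse l)      ≡⟨ reverse-involutive l ⟩
      l                        ∎

cancel-leading-zeros : ∀ {zs r s} k → All (_≡ false) zs →
                       zs ++ true ∷ r ≡ replicate k false ++ true ∷ s → r ≡ s
cancel-leading-zeros zero    []           refl = refl
cancel-leading-zeros (suc k) []           ()
cancel-leading-zeros zero    (refl ∷ _)   ()
cancel-leading-zeros (suc k) (refl ∷ zs₀) eq   = cancel-leading-zeros k zs₀ (cong (drop 1) eq)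

iter-+ : ∀ {A : Set} i j (f : A → A) x → iter (i + j) f x ≡ iter i f (iter j f x)
iter-+ zero    j f x = refl
iter-+ (suc i) j f x = cong f (iter-+ i j f x)

init-∷ʳ-last : ∀ {A : Set} {n} (v : Vec A (suc n)) → v ≡ V.init v V.∷ʳ V.last v
init-∷ʳ-last v = proj₂ (proj₂ (V.initLast v))

toList-α : ∀ {n} (v : BinStr n) {xs x} → toList v ≡ xs ++ [ x ] → toList (α v) ≡ x ∷ xs
toList-α []      {[]}    ()
toList-α []      {_ ∷ _} ()
toList-α (y ∷ v) {xs}    eq = cong₂ _∷_ (proj₂ init,last≡) (proj₁ init,last≡)
  where
  init,last≡ : toList (V.init (y ∷ v)) ≡ xs × V.last (y ∷ v) ≡ _
  init,last≡ = ∷ʳ-injective _ xs (begin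
    toList (V.init (y ∷ v)) ∷ʳ V.last (y ∷ v)   ≡⟨ V.toList-∷ʳ _ (V.init (y ∷ v)) ⟨
    toList (V.init (y ∷ v) V.∷ʳ V.last (y ∷ v)) ≡⟨ cong toList (init-∷ʳ-last (y ∷ v)) ⟨
    toList (y ∷ v)                               ≡⟨ eq ⟩
    xs ∷ʳ _                                      ∎)

toList-iter-α : ∀ {n} (v : BinStr n) xs ys → toList v ≡ xs ++ ys → toList (iter (length ys) α v) ≡ ys ++ xs
toList-iter-α v xs []       eq = trans eq (++-identityʳ xs)
toList-iter-α v xs (y ∷ ys) eq = toList-α (iter (length ys) α v) (begin
  toList (iter (length ys) α v) ≡⟨ toList-iter-α v (xs ∷ʳ y) ys (trans eq (sym (++-assoc xs [ y ] ys))) ⟩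
  ys ++ (xs ∷ʳ y)               ≡⟨ ++-assoc ys xs [ y ] ⟨
  (ys ++ xs) ∷ʳ y               ∎)

rotation-split : ∀ {n k} (v : BinStr n) → k ≤ n →
                 ∃₂ λ xs ys → toList v ≡ xs ++ ys × length ys ≡ k × toList (iter k α v) ≡ ys ++ xs
rotation-split v k≤n
  with xs , ys , v≡ , refl ← split-with-suffix-length (toList v) (subst (_ ≤_) (sym (V.length-toList v)) k≤n)
  = xs , ys , v≡ , refl , toList-iter-α v xs ys v≡

iter-α-period : ∀ {n} (v : BinStr n) → iter n α v ≡ v
iter-α-period {n} v = trans (sym (cast-is-id refl _)) (V.toList-injective refl _ _ (begin
  toList (iter n α v)                   ≡⟨ cong (λ k → toList (iter k α v)) (V.length-toList v) ⟨
  toList (iter (length (toList v)) α v) ≡⟨ toList-iter-α v [] (toList v) refl ⟩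
  toList v ++ []                        ≡⟨ ++-identityʳ (toList v) ⟩
  toList v                              ∎))

α-injective : ∀ {n} {v w : BinStr n} → α v ≡ α w → v ≡ w
α-injective {v = []}    {[]}    _  = refl
α-injective {v = x ∷ v} {y ∷ w} eq = begin
  x ∷ v                                 ≡⟨ init-∷ʳ-last (x ∷ v) ⟩
  V.init (x ∷ v) V.∷ʳ V.last (x ∷ v)    ≡⟨ cong₂ V._∷ʳ_ (V.∷-injectiveʳ eq) (V.∷-injectiveˡ eq) ⟩
  V.init (y ∷ w) V.∷ʳ V.last (y ∷ w)    ≡⟨ init-∷ʳ-last (y ∷ w) ⟨
  y ∷ w                                 ∎

iter-α-injective : ∀ {n} k {v w : BinStr n} → iter k α v ≡ iter k α w → v ≡ w
iter-α-injective zero    eq = eq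
iter-α-injective (suc k) eq = iter-α-injective k (α-injective eq)

iter-α-cancel : ∀ {n i j} {v w : BinStr n} → i ≤ j → iter i α v ≡ iter j α w → v ≡ iter (j ∸ i) α w
iter-α-cancel {i = i} {j} {w = w} i≤j eq = iter-α-injective i (begin
  _                           ≡⟨ eq ⟩
  iter j α w                  ≡⟨ cong (λ k → iter k α w) (m+[n∸m]≡n i≤j) ⟨
  iter (i + (j ∸ i)) α w      ≡⟨ iter-+ i (j ∸ i) α w ⟩
  iter i α (iter (j ∸ i) α w) ∎)

iter-α-difference : ∀ {n i j} {v w : BinStr n} → i ≤ n → j ≤ n →
                    iter i α v ≡ iter j α w → ∃ λ k → k ≤ n × v ≡ iter k α w
iter-α-difference {n} {i} {j} {v} {w} i≤n j≤n eq with i ≤? j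
... | yes i≤j = j ∸ i , ≤-trans (m∸n≤m j i) j≤n , iter-α-cancel i≤j eq
... | no  i≰j = n ∸ t , m∸n≤m n t , (begin
  v                           ≡⟨ iter-α-period v ⟨
  iter n α v                  ≡⟨ cong (λ k → iter k α v) (m∸n+n≡m t≤n) ⟨
  iter ((n ∸ t) + t) α v      ≡⟨ iter-+ (n ∸ t) t α v ⟩
  iter (n ∸ t) α (iter t α v) ≡⟨ cong (iter (n ∸ t) α) w≡ ⟨
  iter (n ∸ t) α w            ∎)
  where
  t = i ∸ j
  w≡ : w ≡ iter t α v
  w≡ = iter-α-cancel (<⇒≤ (≰⇒> i≰j)) (sym eq)
  t≤n : t ≤ n
  t≤n = ≤-trans (m∸n≤m i j) i≤n

primitive⇒iter-α≢ : ∀ {n k} {v : BinStr n} → Primitive (toList v) → 0 < k → k < n → iter k α v ≢ v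
primitive⇒iter-α≢ {v = v} prim 0<k k<n αᵏv≡v
  with xs , ys , v≡ , ∣ys∣≡k , αᵏv≡ ← rotation-split v (<⇒≤ k<n)
  with prim xs ys v≡ (trans (sym αᵏv≡) (cong toList αᵏv≡v))
... | inj₁ refl = <-irrefl (trans (sym ∣ys∣≡k) (trans (cong length (sym v≡)) (V.length-toList v))) k<n
... | inj₂ refl = <-irrefl ∣ys∣≡k 0<k

chiral⇒iter-α≢β : ∀ {n k} {v : BinStr n} → Chiral (toList v) → k ≤ n → iter k α v ≢ β v
chiral⇒iter-α≢β {v = v} chiral k≤n αᵏv≡βv
  with xs , ys , v≡ , _ , αᵏv≡ ← rotation-split v k≤n
  = chiral xs ys v≡ (trans (sym αᵏv≡) (trans (cong toList αᵏv≡βv) (V.toList-reverse v)))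

rotations-distinct : ∀ {n} {v : BinStr n} → Primitive (toList v) →
                     ∀ {i j} → i < j → j < n → iter i α v ≢ iter j α v
rotations-distinct prim {i} {j} i<j j<n αⁱv≡αʲv =
  primitive⇒iter-α≢ prim (m<n⇒0<n∸m i<j) (≤-<-trans (m∸n≤m j i) j<n) (sym (iter-α-cancel (<⇒≤ i<j) αⁱv≡αʲv))

rotation≢reflection : ∀ {n} {v : BinStr n} → Chiral (toList v) →
                      ∀ {i j} → i < n → j < n → iter i α v ≢ iter j α (β v)
rotation≢reflection chiral i<n j<n αⁱv≡αʲβv
  with k , k≤n , βv≡ ← iter-α-difference (<⇒≤ j<n) (<⇒≤ i<n) (sym αⁱv≡αʲβv)
  = chiral⇒iter-α≢β chiral k≤n (sym βv≡)

orbitList≡applyUpTo : ∀ {n} (u : BinStr n) →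
                      orbitList u ≡ applyUpTo (λ k → iter k α u) n ++ applyUpTo (λ k → iter k α (β u)) n
orbitList≡applyUpTo {n} u = cong₂ _++_ (map-applyUpTo id _ n) (map-applyUpTo id _ n)

orbitList-Unique : ∀ {n} (u : BinStr n) → Primitive (toList u) → Chiral (toList u) → Unique (orbitList u)
orbitList-Unique {n} u prim chiral = subst Unique (sym (orbitList≡applyUpTo u)) (Unique.++⁺
  (Unique.applyUpTo⁺₁ _ n (rotations-distinct prim))
  (Unique.applyUpTo⁺₁ _ n (rotations-distinct (subst Primitive (sym (V.toList-reverse u)) (primitive-reverse prim))))
  rotations#reflections)
  where
  rotations#reflections : Disjoint (applyUpTo (λ k → iter k α u) n) (applyUpTo (λ k → iter k α (β u)) n)
  rotations#reflections (v∈rotations , v∈reflections)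
    with i , i<n , refl ← ∈-applyUpTo⁻ _ v∈rotations
       | j , j<n , αⁱu≡αʲβu ← ∈-applyUpTo⁻ _ v∈reflections
    = rotation≢reflection chiral i<n j<n αⁱu≡αʲβu

primitive∧chiral⇒asymmetric : ∀ {n} (u : BinStr n) → Primitive (toList u) → Chiral (toList u) → Asymmetric u
primitive∧chiral⇒asymmetric {n} u prim chiral = begin
  length (deduplicate _ (orbitList u))            ≡⟨ cong length (deduplicate-Unique _ (orbitList-Unique u prim chiral)) ⟩
  length (orbitList u)                            ≡⟨ cong length (orbitList≡applyUpTo u) ⟩
  length (applyUpTo _ n ++ applyUpTo _ n)         ≡⟨ length-++ (applyUpTo _ n) ⟩
  length (applyUpTo _ n) + length (applyUpTo _ n) ≡⟨ cong₂ _+_ (length-applyUpTo _ n) (length-applyUpTo _ n) ⟩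
  n + n                                           ∎

block : List Bool
block = true ∷ false ∷ true ∷ false ∷ false ∷ true ∷ []

witness : ∀ m → BinStr (9 + m)
witness m = true ∷ false ∷ true ∷ false ∷ false ∷ true ∷ V.replicate (3 + m) false

toList-witness : ∀ m → toList (witness m) ≡ block ++ replicate (3 + m) false
toList-witness m = cong (block ++_) (V.toList-replicate (3 + m) false)

primitive-block++zeros : ∀ m → Primitive (block ++ replicate (3 + m) false)
primitive-block++zeros m []                                                 _ _    _  = inj₁ refl
primitive-block++zeros m (false ∷ _)                                        _ ()
primitive-block++zeros m (true ∷ [])                                        _ refl ()
primitive-block++zeros m (true ∷ true ∷ _)                                  _ ()
primitive-block++zeros m (true ∷ false ∷ [])                                _ refl ()
primitive-block++zeros m (true ∷ false ∷ false ∷ _)                         _ ()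
primitive-block++zeros m (true ∷ false ∷ true ∷ [])                         _ refl ()
primitive-block++zeros m (true ∷ false ∷ true ∷ true ∷ _)                   _ ()
primitive-block++zeros m (true ∷ false ∷ true ∷ false ∷ [])                 _ refl ()
primitive-block++zeros m (true ∷ false ∷ true ∷ false ∷ true ∷ _)           _ ()
primitive-block++zeros m (true ∷ false ∷ true ∷ false ∷ false ∷ [])         _ refl ()
primitive-block++zeros m (true ∷ false ∷ true ∷ false ∷ false ∷ false ∷ _)  _ ()
primitive-block++zeros m (true ∷ false ∷ true ∷ false ∷ false ∷ true ∷ _)   [] _ _ = inj₂ refl
-- ys is a nonempty tail of the zeros, so the rotation starts with 0
primitive-block++zeros m (true ∷ false ∷ true ∷ false ∷ false ∷ true ∷ zs) (_ ∷ _) l≡ rot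
  with refl ∷ _ ← ++-≡-replicate⇒Allʳ zs (sym (cong (drop 6) l≡)) = case rot of λ ()

chiral-block++zeros : ∀ m → Chiral (block ++ replicate (3 + m) false)
chiral-block++zeros m xs ys l≡ rot = not-rotation xs ys l≡ (trans rot reverse-l)
  where
  reverse-l : reverse (block ++ replicate (3 + m) false) ≡ replicate (3 + m) false ++ reverse block
  reverse-l = trans (reverse-++ block (replicate (3 + m) false))
                    (cong (_++ reverse block) (reverse-replicate (3 + m) false))
  not-rotation : ∀ xs ys → block ++ replicate (3 + m) false ≡ xs ++ ys →
                 ys ++ xs ≢ replicate (3 + m) false ++ reverse block
  not-rotation []                                                 _ refl ()
  not-rotation (false ∷ _)                                        _ ()
  not-rotation (true ∷ [])                                        _ refl ()
  not-rotation (true ∷ true ∷ _)                                  _ ()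
  not-rotation (true ∷ false ∷ [])                                _ refl ()
  not-rotation (true ∷ false ∷ false ∷ _)                         _ ()
  not-rotation (true ∷ false ∷ true ∷ [])                         _ refl ()
  not-rotation (true ∷ false ∷ true ∷ true ∷ _)                   _ ()
  not-rotation (true ∷ false ∷ true ∷ false ∷ [])                 _ refl ()
  not-rotation (true ∷ false ∷ true ∷ false ∷ true ∷ _)           _ ()
  not-rotation (true ∷ false ∷ true ∷ false ∷ false ∷ [])         _ refl ()
  not-rotation (true ∷ false ∷ true ∷ false ∷ false ∷ false ∷ _)  _ ()
  -- ys is a run of zeros; after the first 1 the rotation reads 0 1 …, the reversal 0 0 …
  not-rotation (true ∷ false ∷ true ∷ false ∷ false ∷ true ∷ zs) ys l≡ rot =
    case cancel-leading-zeros (3 + m) (++-≡-replicate⇒Allʳ zs (sym (cong (drop 6) l≡))) rot of λ ()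

witness-asymmetric : ∀ m → Asymmetric (witness m)
witness-asymmetric m = primitive∧chiral⇒asymmetric (witness m)
  (subst Primitive (sym (toList-witness m)) (primitive-block++zeros m))
  (subst Chiral (sym (toList-witness m)) (chiral-block++zeros m))

zeros-NoAdj11 : ∀ k → NoAdj11 (false ∷ V.replicate k false)
zeros-NoAdj11 zero    = one false
zeros-NoAdj11 (suc k) = cons0 (zeros-NoAdj11 k)

last-replicate : ∀ {A : Set} k (x : A) → V.last (x ∷ V.replicate k x) ≡ x
last-replicate zero    x = refl
last-replicate (suc k) x = last-replicate k x

witness-Lucas : ∀ m → IsLucas (witness m)
witness-Lucas m = cons1 (cons0 (cons1 (cons0 (cons0 (cons1 (zeros-NoAdj11 (2 + m)))))))
                , λ (_ , last≡true) → case trans (sym (last-replicate (2 + m) false)) last≡true of λ ()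

noAdj11? : ∀ {n} (v : BinStr n) → Dec (NoAdj11 v)
noAdj11? []                = yes nil
noAdj11? (b ∷ [])          = yes (one b)
noAdj11? (false ∷ b ∷ v)   = map′ cons0 (λ { (cons0 p) → p }) (noAdj11? (b ∷ v))
noAdj11? (true ∷ false ∷ v) = map′ cons1 (λ { (cons1 p) → p }) (noAdj11? (false ∷ v))
noAdj11? (true ∷ true ∷ v)  = no λ ()

isLucas? : ∀ {n} (v : BinStr n) → Dec (IsLucas v)
isLucas? []      = yes nil
isLucas? (b ∷ v) = noAdj11? (b ∷ v) ×-dec ¬? ((b ≟ᵇ true) ×-dec (V.last (b ∷ v) ≟ᵇ true))

asymmetric? : ∀ {n} (v : BinStr n) → Dec (Asymmetric v)
asymmetric? {n} v = orbitSize v ≟ n + n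

∀-BinStr? : ∀ {n} {P : BinStr n → Set} → (∀ v → Dec (P v)) → Dec (∀ v → P v)
∀-BinStr? {zero}  P? = map′ (λ p → λ { [] → p }) (λ ∀P → ∀P []) (P? [])
∀-BinStr? {suc n} P? = map′ (λ (P₁ , P₀) → λ { (true ∷ v) → P₁ v ; (false ∷ v) → P₀ v })
                             (λ ∀P → ∀P ∘ (true ∷_) , ∀P ∘ (false ∷_))
                             (∀-BinStr? (P? ∘ (true ∷_)) ×-dec ∀-BinStr? (P? ∘ (false ∷_)))

NoAsymmetricLucas : ℕ → Set
NoAsymmetricLucas n = (u : BinStr n) → ¬ (IsLucas u × Asymmetric u)

noAsymmetricLucas? : ∀ n → Dec (NoAsymmetricLucas n)
noAsymmetricLucas? n = ∀-BinStr? λ u → ¬? (isLucas? u ×-dec asymmetric? u)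

no-asymmetric-Lucas-below-9 : ∀ n → suc n < 9 → NoAsymmetricLucas (suc n)
no-asymmetric-Lucas-below-9 n 1+n<9 = subst (NoAsymmetricLucas ∘ suc) (Fin.toℕ-fromℕ< n<8) (checked (fromℕ< n<8))
  where
  n<8 : n < 8
  n<8 = s<s⁻¹ 1+n<9
  checked : ∀ (i : Fin 8) → NoAsymmetricLucas (suc (toℕ i))
  checked = from-yes (Fin.all? {n = 8} λ i → noAsymmetricLucas? (suc (toℕ i)))

lemma5p3 : (n : ℕ) → (∃ λ (u : BinStr (suc n)) → IsLucas u × Asymmetric u) ⇔ (suc n ≥ 9)
lemma5p3 n = mk⇔ at-least-9 asymmetric-Lucas
  where
  at-least-9 : (∃ λ (u : BinStr (suc n)) → IsLucas u × Asymmetric u) → suc n ≥ 9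
  at-least-9 (u , lucas , asym) = ≮⇒≥ λ 1+n<9 → no-asymmetric-Lucas-below-9 n 1+n<9 u (lucas , asym)
  asymmetric-Lucas : suc n ≥ 9 → ∃ λ (u : BinStr (suc n)) → IsLucas u × Asymmetric u
  asymmetric-Lucas (s≤s 8≤n) = subst (λ k → ∃ λ (u : BinStr (suc k)) → IsLucas u × Asymmetric u) (m+[n∸m]≡n 8≤n)
    (witness (n ∸ 8) , witness-Lucas (n ∸ 8) , witness-asymmetric (n ∸ 8))
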